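{- Let $L,M,N$ be finite sets, $\delta:L^{(2)}\to M$, $\varepsilon:L^{(2)}\to 2^N$, and $M_\emptyset\subseteq M$. Then $(\delta,\varepsilon)$ is $M_\emptyset$-tree-like if and only if $(\delta,\varepsilon)$ is tree-like and its least-resolved tree $(T^*,t^*,\lambda^*)$ satisfies conditions (C) and (C1).
   Context: $L^{(2)}=\{(x,y)\mid x,y\in L,\ x\ne y\}$. Trees are rooted phylogenetic (every inner vertex has $\ge2$ children) with leaf set $L$; $V^0(T)$ is the set of inner vertices, $\operatorname{child}(v)$ the children of $v$, $L(T(u))$ the leaves below $u$, $\mathcal{H}(T)=\{L(T(u))\mid u\in V(T)\}$. $(T,t)$ with $t:V^0(T)\to M$ explains $\delta$ if $t(\operatorname{lca}_T(x,y))=\delta(x,y)$ for all $(x,y)\in L^{(2)}$. $(T,\lambda)$ with $\lambda:E(T)\to2^N$ explains $\varepsilon$ if $k\in\varepsilon(x,y)$ iff $k\in\lambda(e)$ for some edge $e$ on the path from $\operatorname{lca}_T(x,y)$ to $y$. $(\delta,\varepsilon)$ is tree-like if some $(T,t,\lambda)$ has $(T,t)$ explaining $\delta$ and $(T,\lambda)$ explaining $\varepsilon$. Condition (C): for every $v\in V^0(T)$ there is $u\in\operatorname{child}(v)$ with $\lambda(\{v,u\})=\emptyset$. Condition (C1): if $t(v)\in M_\emptyset$ then $\lambda(\{v,u\})=\emptyset$ for all $u\in\operatorname{child}(v)$. $(\delta,\varepsilon)$ is $M_\emptyset$-tree-like if some $(T,t,\lambda)$ explaining $(\delta,\varepsilon)$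 satisfies (C) and (C1). If $(\delta,\varepsilon)$ is tree-like, then $\delta$ has a unique explaining tree $(T_\delta,t_\delta)$ with discriminating labeling (labels differ at the ends of each inner edge), $\varepsilon$ has a least-resolved tree $(T_\varepsilon,\lambda_\varepsilon)$ with $\mathcal{H}(T_\varepsilon)=\{U_{\neg m}[y]\mid y\in L,m\in N\}\cup\{L\}\cup\{\{x\}\mid x\in L\}$, $U_{\neg m}[y]=\{x\ne y\mid m\notin\varepsilon(x,y)\}\cup\{y\}$, $\lambda_\varepsilon(\{\operatorname{parent}(v),v\})=\{m\mid\exists y:L(T_\varepsilon(v))=U_{\neg m}[y]\}$; and the least-resolved tree $(T^*,t^*,\lambda^*)$ of $(\delta,\varepsilon)$ is the tree with $\mathcal{H}(T^*)=\mathcal{H}(T_\delta)\cup\mathcal{H}(T_\varepsilon)$, $t^*$ the unique labeling with $(T^*,t^*)$ explaining $\delta$, and $\lambda^*(\{\operatorname{parent}(v),v\})=\lambda_\varepsilon(\{\operatorname{parent}(v'),v'\})$ if $L(T^*(v))=L(T_\varepsilon(v'))$ for some $v'\in V(T_\varepsilon)$ and $\emptyset$ otherwise. -}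

module Defs where

open import Data.Nat using (ℕ; zero; suc)
open import Data.Fin using (Fin)
open import Data.Fin.Subset using (Subset; _∈_; _∉_; Empty)
open import Data.Product using (Σ; ∃; ∃₂; _×_; _,_)
open import Data.Sum using (_⊎_)
open import Relation.Binary.PropositionalEquality using (_≡_; _≢_)
open import Relation.Nullary using (¬_)

_↔_ : Set → Set → Set
P ↔ Q = (P → Q) × (Q → P)
infix 2 _↔_

iterate : {A : Set} → (A → A) → ℕ → A → A
iterate f zero a = a
iterate f (suc k) a = f (iterate f k a)

-- A rooted tree with leaf set L = Fin n.  Vertices are Fin size; the root is
-- the unique fixed point of parent.  The edge {parent v , v} (v ≠ root) is
-- identified with its lower end v.
record RawTree (n : ℕ) : Set where
  field
    size   : ℕ
    root   : Fin size
    parent : Fin size → Fin size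
    leaf   : Fin n → Fin size
open RawTree public

module _ {n : ℕ} (T : RawTree n) where
  Vtx : Set
  Vtx = Fin (size T)

  Below : Vtx → Vtx → Set
  Below u v = ∃ λ k → iterate (parent T) k u ≡ v

  IsChild : Vtx → Vtx → Set
  IsChild u v = (u ≢ root T) × (parent T u ≡ v)

  IsInner : Vtx → Set
  IsInner v = ∃ λ u → IsChild u v

  record IsPhylo : Set where
    field
      root-fix       : parent T (root T) ≡ root T
      root-unique    : ∀ v → parent T v ≡ v → v ≡ root T
      reaches-root   : ∀ v → Below v (root T)
      leaf-injective : ∀ x y → leaf T x ≡ leaf T y → x ≡ y
      leaf-noChild   : ∀ x → ¬ IsInner (leaf T x)
      noChild-leaf   : ∀ v → ¬ IsInner v → ∃ λ x → leaf T x ≡ v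
      phylogenetic   : ∀ v → IsInner v →
                       ∃₂ λ u w → (u ≢ w) × IsChild u v × IsChild w v

  ClusterOf : Vtx → Subset n → Set
  ClusterOf v A = ∀ x → (x ∈ A) ↔ Below (leaf T x) v

  InH : Subset n → Set
  InH A = ∃ λ v → ClusterOf v A

  IsLca : Fin n → Fin n → Vtx → Set
  IsLca x y w = Below (leaf T x) w × Below (leaf T y) w ×
                (∀ w' → Below (leaf T x) w' → Below (leaf T y) w' → Below w w')

  ExplainsΔ : {p : ℕ} → (Vtx → Fin p) → (Fin n → Fin n → Fin p) → Set
  ExplainsΔ t δ = ∀ x y → x ≢ y → ∀ w → IsLca x y w → t w ≡ δ x y

  ExplainsΕ : {k : ℕ} → (Vtx → Subset k) → (Fin n → Fin n → Subset k) → Set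
  ExplainsΕ lab ε = ∀ x y → x ≢ y → ∀ w → IsLca x y w → ∀ m →
    (m ∈ ε x y) ↔ (∃ λ u → Below (leaf T y) u × Below u w × (u ≢ w) × (m ∈ lab u))

  Discriminating : {p : ℕ} → (Vtx → Fin p) → Set
  Discriminating t = ∀ v → v ≢ root T → IsInner v → t (parent T v) ≢ t v

  CondC : {k : ℕ} → (Vtx → Subset k) → Set
  CondC lab = ∀ v → IsInner v → ∃ λ u → IsChild u v × Empty (lab u)

  CondC1 : {p k : ℕ} → Subset p → (Vtx → Fin p) → (Vtx → Subset k) → Set
  CondC1 M∅ t lab = ∀ v → IsInner v → t v ∈ M∅ → ∀ u → IsChild u v → Empty (lab u)

module _ {n k : ℕ} (ε : Fin n → Fin n → Subset k) where
  IsU : Fin k → Fin n → Subset n → Set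
  IsU m y A = ∀ x → (x ∈ A) ↔ ((x ≡ y) ⊎ ((x ≢ y) × (m ∉ ε x y)))

  InHε : Subset n → Set
  InHε A = (∃₂ λ y m → IsU m y A)
         ⊎ (∀ x → x ∈ A)
         ⊎ (∃ λ y → ∀ x → (x ∈ A) ↔ (x ≡ y))

module _ {n p k : ℕ} (δ : Fin n → Fin n → Fin p) (ε : Fin n → Fin n → Subset k) where
  TreeLike : Set
  TreeLike = ∃ λ (T : RawTree n) → ∃ λ (t : Vtx T → Fin p) → ∃ λ (lab : Vtx T → Subset k) →
    IsPhylo T × ExplainsΔ T t δ × ExplainsΕ T lab ε

  M∅TreeLike : Subset p → Set
  M∅TreeLike M∅ = ∃ λ (T : RawTree n) → ∃ λ (t : Vtx T → Fin p) → ∃ λ (lab : Vtx T → Subset k) →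
    IsPhylo T × ExplainsΔ T t δ × ExplainsΕ T lab ε × CondC T lab × CondC1 T M∅ t lab

  IsLeastResolved : (T : RawTree n) → (Vtx T → Fin p) → (Vtx T → Subset k) → Set
  IsLeastResolved T t lab =
    IsPhylo T ×
    -- H(T*) = H(T_δ) ∪ H(T_ε), T_δ the discriminating tree explaining δ
    (∃ λ (Tδ : RawTree n) → ∃ λ (tδ : Vtx Tδ → Fin p) →
       IsPhylo Tδ × ExplainsΔ Tδ tδ δ × Discriminating Tδ tδ ×
       (∀ A → InH T A ↔ (InH Tδ A ⊎ InHε ε A))) ×
    ExplainsΔ T t δ ×
    -- λ*({parent v , v}) = λ_ε of the matching edge of T_ε, ∅ if none
    (∀ v → v ≢ root T → ∀ A → ClusterOf T v A → ∀ m →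
       (m ∈ lab v) ↔ (InHε ε A × (∃ λ y → IsU ε m y A)))

{-# OPTIONS --safe #-}
module Submission where

-- The least-resolved tree T* is displayed by every tree (T, t, λ) explaining (δ, ε): a cluster of the
-- discriminating tree is cut off in T by an edge across which t changes, and U_{¬m}[y] is the cluster of the
-- lowest ancestor of y that is the root or carries m on the edge above it. Conversely, contracting T onto the
-- vertices of these two kinds yields T*. So if T satisfies (C) and (C1), so does T*: an m on the T*-edge above a
-- child u of v is an m on the T-edge above the image of u; a descent in T along unlabelled edges from the image
-- of v therefore ends in a leaf whose T*-child of v is unlabelled, and (C1) applies at the parent of the image
-- of u, since t is constant from there up to the image of v, which carries t*(v).

open import Defs
open import Data.Nat using (ℕ; zero; suc; _+_; _*_; _∸_)
open import Data.Nat.Properties using (_≤?_; m∸n+n≡m; m≤m*n; ≰⇒>; <⇒≤; +-suc)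
open import Data.Fin using (Fin; zero; suc; _≟_)
import Data.Fin.Properties as Finₚ
open import Data.Fin.Induction using (po-wellFounded; po-noetherian)
open import Data.Fin.Subset using (Subset; _∈_; _∉_; Empty)
open import Data.Fin.Subset.Properties using (_∈?_)
open import Data.Vec using (tabulate)
open import Data.Vec.Properties using (lookup∘tabulate; lookup⇒[]=; []=⇒lookup)
open import Data.Unit using (⊤; tt)
open import Data.Product using (∃; ∃₂; _×_; _,_; proj₁; proj₂)
open import Data.Sum using (_⊎_; inj₁; inj₂)
open import Data.Empty using (⊥; ⊥-elim)
open import Function using (_∘_; flip)
open import Induction.WellFounded using (WellFounded; Acc; acc)
open import Relation.Binary.Structures using (IsPartialOrder)
open import Relation.Binary.PropositionalEquality
open import Relation.Nullary using (Dec; yes; no; ¬_; does; contradiction)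
open import Relation.Nullary.Decidable using (map′; ¬?; _×-dec_; _⊎-dec_; _→-dec_; decidable-stable; dec-true)
open import Relation.Unary using (Decidable)

≢-by : ∀ {A : Set} {Pr : A → Set} {a b} → Pr a → ¬ Pr b → a ≢ b
≢-by Pr-a ¬Pr-b refl = ¬Pr-b Pr-a

∈-tabulate-does : ∀ {k} {X : Fin k → Set} (X? : Decidable X) m → (m ∈ tabulate (does ∘ X?)) ↔ X m
∈-tabulate-does {X = X} X? m = ∈⇒X , X⇒∈
  where
  ∈⇒X : m ∈ tabulate (does ∘ X?) → X m
  ∈⇒X m∈ with X? m | trans (sym (lookup∘tabulate (does ∘ X?) m)) ([]=⇒lookup m∈)
  ... | yes Xm | _ = Xm
  ... | no  _  | ()
  X⇒∈ : X m → m ∈ tabulate (does ∘ X?)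
  X⇒∈ Xm = lookup⇒[]= m _ (trans (lookup∘tabulate (does ∘ X?) m) (dec-true (X? m) Xm))

-- Enumerating a decidable subset of Fin s

module _ {A : Set} where

  consIf : Dec A → ℕ → ℕ
  consIf (yes _) m = suc m
  consIf (no  _) m = m

  consIf-embed : ∀ {s m} (a? : Dec A) → (Fin m → Fin s) → Fin (consIf a? m) → Fin (suc s)
  consIf-embed (yes _) f zero    = zero
  consIf-embed (yes _) f (suc i) = suc (f i)
  consIf-embed (no  _) f i       = suc (f i)

count : ∀ {s} {Keep : Fin s → Set} → Decidable Keep → ℕ
count {zero}  Keep? = zero
count {suc s} Keep? = consIf (Keep? zero) (count (Keep? ∘ suc))

embed : ∀ {s} {Keep : Fin s → Set} (Keep? : Decidable Keep) → Fin (count Keep?) → Fin s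
embed {suc s} Keep? = consIf-embed (Keep? zero) (embed (Keep? ∘ suc))

embed-kept : ∀ {s} {Keep : Fin s → Set} (Keep? : Decidable Keep) i → Keep (embed Keep? i)
embed-kept {suc s} Keep? i with Keep? zero
embed-kept {suc s} Keep? zero    | yes k = k
embed-kept {suc s} Keep? (suc i) | yes _ = embed-kept (Keep? ∘ suc) i
embed-kept {suc s} Keep? i       | no  _ = embed-kept (Keep? ∘ suc) i

index : ∀ {s} {Keep : Fin s → Set} (Keep? : Decidable Keep) v → Keep v → Fin (count Keep?)
index {suc s} Keep? zero    k with Keep? zero
... | yes _  = zero
... | no  ¬k = contradiction k ¬k
index {suc s} Keep? (suc v) k with Keep? zero
... | yes _ = suc (index (Keep? ∘ suc) v k)
... | no  _ = index (Keep? ∘ suc) v k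

embed-index : ∀ {s} {Keep : Fin s → Set} (Keep? : Decidable Keep) v (k : Keep v) → embed Keep? (index Keep? v k) ≡ v
embed-index {suc s} Keep? zero    k with Keep? zero
... | yes _  = refl
... | no  ¬k = contradiction k ¬k
embed-index {suc s} Keep? (suc v) k with Keep? zero
... | yes _ = cong suc (embed-index (Keep? ∘ suc) v k)
... | no  _ = cong suc (embed-index (Keep? ∘ suc) v k)

embed-injective : ∀ {s} {Keep : Fin s → Set} (Keep? : Decidable Keep) {i j} → embed Keep? i ≡ embed Keep? j → i ≡ j
embed-injective {suc s} Keep? {i} {j} eq with Keep? zero
embed-injective {suc s} Keep? {zero}  {zero}  eq | yes _ = refl
embed-injective {suc s} Keep? {suc i} {suc j} eq | yes _ = cong suc (embed-injective (Keep? ∘ suc) (Finₚ.suc-injective eq))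
embed-injective {suc s} Keep? {i}     {j}     eq | no  _ = embed-injective (Keep? ∘ suc) (Finₚ.suc-injective eq)

-- The ancestor order of a rooted tree

iterate-+ : ∀ {A : Set} (f : A → A) a b x → iterate f (a + b) x ≡ iterate f a (iterate f b x)
iterate-+ f zero    b x = refl
iterate-+ f (suc a) b x = cong f (iterate-+ f a b x)

iterate-suc : ∀ {A : Set} (f : A → A) k x → iterate f (suc k) x ≡ iterate f k (f x)
iterate-suc f zero    x = refl
iterate-suc f (suc k) x = cong f (iterate-suc f k x)

module _ {n : ℕ} (T : RawTree n) (root-fix : parent T (root T) ≡ root T) where

  child-on-iterated-path : ∀ k u v → iterate (parent T) k u ≡ v → u ≢ v →
                           ∃ λ c → IsChild T c v × Below T u c
  child-on-iterated-path zero    u v u≡v u≢v = contradiction u≡v u≢v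
  child-on-iterated-path (suc k) u v pᵏ⁺¹u≡v u≢v with iterate (parent T) k u ≟ v
  ... | yes pᵏu≡v = child-on-iterated-path k u v pᵏu≡v u≢v
  ... | no  pᵏu≢v = iterate (parent T) k u , (pᵏu≢root , pᵏ⁺¹u≡v) , (k , refl)
    where
    pᵏu≢root : iterate (parent T) k u ≢ root T
    pᵏu≢root pᵏu≡r = pᵏu≢v (trans pᵏu≡r (trans (sym root-fix)
                             (trans (cong (parent T) (sym pᵏu≡r)) pᵏ⁺¹u≡v)))

inner? : ∀ {n} (T : RawTree n) v → Dec (IsInner T v)
inner? T v = Finₚ.any? (λ u → ¬? (u ≟ root T) ×-dec (parent T u ≟ v))

module Ancestry {n : ℕ} (T : RawTree n) (P : IsPhylo T) where
  open IsPhylo P public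

  private
    p = parent T
    r = root T

  V : Set
  V = Vtx T

  infix 4 _≼_ _≺_

  _≼_ : V → V → Set
  _≼_ = Below T

  _≺_ : V → V → Set
  u ≺ v = u ≼ v × u ≢ v

  ≼-refl : ∀ {u} → u ≼ u
  ≼-refl = zero , refl

  ≼-reflexive : ∀ {u v} → u ≡ v → u ≼ v
  ≼-reflexive refl = ≼-refl

  ≼-trans : ∀ {u v w} → u ≼ v → v ≼ w → u ≼ w
  ≼-trans {u} (k , refl) (j , refl) = j + k , iterate-+ p j k u

  ≼-parent : ∀ u → u ≼ p u
  ≼-parent u = 1 , refl

  ≼-total : ∀ {u a b} → u ≼ a → u ≼ b → a ≼ b ⊎ b ≼ a
  ≼-total {u} (i , refl) (j , refl) with i ≤? j
  ... | yes i≤j = inj₁ (j ∸ i , trans (sym (iterate-+ p (j ∸ i) i u)) (cong (λ k → iterate p k u) (m∸n+n≡m i≤j)))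
  ... | no  i≰j = inj₂ (i ∸ j , trans (sym (iterate-+ p (i ∸ j) j u)) (cong (λ k → iterate p k u) (m∸n+n≡m (<⇒≤ (≰⇒> i≰j)))))

  iterate-root : ∀ k → iterate p k r ≡ r
  iterate-root zero    = refl
  iterate-root (suc k) = trans (cong p (iterate-root k)) root-fix

  iterate-periodic : ∀ c u → iterate p c u ≡ u → ∀ t → iterate p (t * c) u ≡ u
  iterate-periodic c u pᶜu≡u zero    = refl
  iterate-periodic c u pᶜu≡u (suc t) =
    trans (iterate-+ p c (t * c) u) (trans (cong (iterate p c) (iterate-periodic c u pᶜu≡u t)) pᶜu≡u)

  -- The root is reached after k steps, hence after k * (1 + c) ≥ k steps; by periodicity that vertex is u.
  periodic⇒root : ∀ c u → iterate p (suc c) u ≡ u → u ≡ r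
  periodic⇒root c u periodic with reaches-root u
  ... | k , pᵏu≡r = begin
    u                                              ≡⟨ sym (iterate-periodic (suc c) u periodic k) ⟩
    iterate p (k * suc c) u                        ≡⟨ cong (λ j → iterate p j u) (sym (m∸n+n≡m (m≤m*n k (suc c)))) ⟩
    iterate p (k * suc c ∸ k + k) u                ≡⟨ iterate-+ p (k * suc c ∸ k) k u ⟩
    iterate p (k * suc c ∸ k) (iterate p k u)      ≡⟨ cong (iterate p (k * suc c ∸ k)) pᵏu≡r ⟩
    iterate p (k * suc c ∸ k) r                    ≡⟨ iterate-root (k * suc c ∸ k) ⟩
    r                                              ∎
    where open ≡-Reasoning

  ≼-antisym : ∀ {u v} → u ≼ v → v ≼ u → u ≡ v
  ≼-antisym (zero  , refl) _ = refl
  ≼-antisym {u} (suc i , refl) (j , pʲv≡u) = trans u≡r (sym (trans (cong (iterate p (suc i)) u≡r) (iterate-root (suc i))))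
    where
    u≡r : u ≡ r
    u≡r = periodic⇒root (j + i) u
            (trans (cong (λ k → iterate p k u) (sym (+-suc j i))) (trans (iterate-+ p j (suc i) u) pʲv≡u))

  ≼-isPartialOrder : IsPartialOrder _≡_ _≼_
  ≼-isPartialOrder = record
    { isPreorder = record { isEquivalence = isEquivalence ; reflexive = ≼-reflexive ; trans = ≼-trans }
    ; antisym    = ≼-antisym
    }

  -- Abstract: only the recursion they allow is needed, and unfolding the pigeonhole argument behind them
  -- exhausts the type checker.
  abstract
    ≺-wellFounded : WellFounded _≺_
    ≺-wellFounded = po-wellFounded ≼-isPartialOrder

    ≻-wellFounded : WellFounded (flip _≺_)
    ≻-wellFounded = po-noetherian ≼-isPartialOrder

  ≺-≼-trans : ∀ {u v w} → u ≺ v → v ≼ w → u ≺ w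
  ≺-≼-trans (u≼v , u≢v) v≼w = ≼-trans u≼v v≼w , λ { refl → u≢v (≼-antisym u≼v v≼w) }

  ≺⇒parent≼ : ∀ {u v} → u ≺ v → p u ≼ v
  ≺⇒parent≼ ((zero  , u≡v)   , u≢v) = contradiction u≡v u≢v
  ≺⇒parent≼ {u} ((suc j , pʲ⁺¹u≡v) , _) = j , trans (sym (iterate-suc p j u)) pʲ⁺¹u≡v

  root≼⇒≡root : ∀ {v} → r ≼ v → v ≡ r
  root≼⇒≡root r≼v = ≼-antisym (reaches-root _) r≼v

  ≺⇒≢root : ∀ {u v} → u ≺ v → u ≢ r
  ≺⇒≢root {u} {v} (u≼v , u≢v) refl = u≢v (sym (root≼⇒≡root u≼v))

  ≢root⇒≺parent : ∀ {u} → u ≢ r → u ≺ p u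
  ≢root⇒≺parent u≢r = ≼-parent _ , λ u≡pu → u≢r (root-unique _ (sym u≡pu))

  child-≺ : ∀ {c v} → IsChild T c v → c ≺ v
  child-≺ (c≢r , refl) = ≢root⇒≺parent c≢r

  child-≼ : ∀ {c v} → IsChild T c v → c ≼ v
  child-≼ = proj₁ ∘ child-≺

  child-≢ : ∀ {c v} → IsChild T c v → c ≢ v
  child-≢ = proj₂ ∘ child-≺

  child-on-path : ∀ {u v} → u ≺ v → ∃ λ c → IsChild T c v × u ≼ c
  child-on-path ((k , pᵏu≡v) , u≢v) = child-on-iterated-path T root-fix k _ _ pᵏu≡v u≢v

  ≼leaf⇒≡leaf : ∀ {u x} → u ≼ leaf T x → u ≡ leaf T x
  ≼leaf⇒≡leaf {u} {x} u≼x with u ≟ leaf T x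
  ... | yes u≡x = u≡x
  ... | no  u≢x with child-on-path (u≼x , u≢x)
  ...   | c , c-child , _ = ⊥-elim (leaf-noChild x (c , c-child))

  children-disjoint : ∀ {c₁ c₂ v u} → IsChild T c₁ v → IsChild T c₂ v → u ≼ c₁ → u ≼ c₂ → c₁ ≡ c₂
  children-disjoint {c₁} {c₂} c₁-child c₂-child u≼c₁ u≼c₂ with c₁ ≟ c₂
  ... | yes c₁≡c₂ = c₁≡c₂
  ... | no  c₁≢c₂ with ≼-total u≼c₁ u≼c₂
  ...   | inj₁ c₁≼c₂ = ⊥-elim (child-≢ c₂-child (≼-antisym (child-≼ c₂-child)
                          (subst (_≼ c₂) (proj₂ c₁-child) (≺⇒parent≼ (c₁≼c₂ , c₁≢c₂)))))
  ...   | inj₂ c₂≼c₁ = ⊥-elim (child-≢ c₁-child (≼-antisym (child-≼ c₁-child)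
                          (subst (_≼ c₁) (proj₂ c₂-child) (≺⇒parent≼ (c₂≼c₁ , c₁≢c₂ ∘ sym)))))

  separated⇒parent≼ : ∀ {c₁ c₂ v a b w} → IsChild T c₁ v → IsChild T c₂ v → c₁ ≢ c₂ →
                      a ≼ c₁ → b ≼ c₂ → a ≼ w → b ≼ w → v ≼ w
  separated⇒parent≼ {c₁} {w = w} c₁-child c₂-child c₁≢c₂ a≼c₁ b≼c₂ a≼w b≼w with ≼-total a≼c₁ a≼w
  ... | inj₂ w≼c₁ = contradiction (children-disjoint c₁-child c₂-child (≼-trans b≼w w≼c₁) b≼c₂) c₁≢c₂
  ... | inj₁ c₁≼w with c₁ ≟ w
  ...   | yes refl  = contradiction (children-disjoint c₁-child c₂-child b≼w b≼c₂) c₁≢c₂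
  ...   | no  c₁≢w = subst (_≼ w) (proj₂ c₁-child) (≺⇒parent≼ (c₁≼w , c₁≢w))

  lca-of-separated : ∀ {c₁ c₂ v x y} → IsChild T c₁ v → IsChild T c₂ v → c₁ ≢ c₂ →
                     leaf T x ≼ c₁ → leaf T y ≼ c₂ → IsLca T x y v
  lca-of-separated c₁-child c₂-child c₁≢c₂ x≼c₁ y≼c₂ =
    ≼-trans x≼c₁ (child-≼ c₁-child) , ≼-trans y≼c₂ (child-≼ c₂-child) ,
    λ _ → separated⇒parent≼ c₁-child c₂-child c₁≢c₂ x≼c₁ y≼c₂

  other-child : ∀ {v c} → IsChild T c v → ∃ λ c′ → IsChild T c′ v × c ≢ c′
  other-child {v} {c} c-child with phylogenetic v (c , c-child)
  ... | a , b , a≢b , a-child , b-child with c ≟ a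
  ...   | yes refl = b , b-child , a≢b
  ...   | no  c≢a  = a , a-child , c≢a

  leaf≢inner : ∀ {x v} → IsInner T v → leaf T x ≢ v
  leaf≢inner {x} inner refl = leaf-noChild x inner

  lca-sym : ∀ {x y v} → IsLca T x y v → IsLca T y x v
  lca-sym (x≼v , y≼v , lowest) = y≼v , x≼v , λ w y≼w x≼w → lowest w x≼w y≼w

  lca-across-child : ∀ {c v x y} → IsChild T c v → leaf T x ≼ c → leaf T y ≼ v → ¬ (leaf T y ≼ c) → IsLca T x y v
  lca-across-child c-child x≼c y≼v y⋠c with child-on-path (y≼v , leaf≢inner (_ , c-child))
  ... | c′ , c′-child , y≼c′ = lca-of-separated c-child c′-child (λ { refl → y⋠c y≼c′ }) x≼c y≼c′

  ≼-dec : ∀ u v → Acc (flip _≺_) u → Dec (u ≼ v)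
  ≼-dec u v (acc above) with u ≟ v
  ... | yes refl = yes ≼-refl
  ... | no  u≢v with u ≟ r
  ...   | yes refl = no λ r≼v → u≢v (sym (root≼⇒≡root r≼v))
  ...   | no  u≢r  = map′ (≼-trans (≼-parent u)) (λ u≼v → ≺⇒parent≼ (u≼v , u≢v))
                          (≼-dec (p u) v (above (≢root⇒≺parent u≢r)))

  _≼?_ : ∀ u v → Dec (u ≼ v)
  u ≼? v = ≼-dec u v (≻-wellFounded u)

  record LowestAncestor (Q : V → Set) (v : V) : Set where
    field
      vertex : V
      above  : v ≼ vertex
      holds  : Q vertex
      lowest : ∀ w → v ≼ w → Q w → vertex ≼ w

    strictly-below⇒¬holds : ∀ w → v ≼ w → w ≺ vertex → ¬ Q w
    strictly-below⇒¬holds w v≼w (w≼vertex , w≢vertex) Qw = w≢vertex (≼-antisym w≼vertex (lowest w v≼w Qw))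

  lowest-ancestor : ∀ {Q : V → Set} → Decidable Q → Q r → ∀ v → LowestAncestor Q v
  lowest-ancestor {Q} Q? Qr v = go v (≻-wellFounded v)
    where
    go : ∀ v → Acc (flip _≺_) v → LowestAncestor Q v
    go v (acc above) with Q? v
    ... | yes Qv = record { vertex = v ; above = ≼-refl ; holds = Qv ; lowest = λ _ v≼w _ → v≼w }
    ... | no ¬Qv with v ≟ r
    ...   | yes refl = contradiction Qr ¬Qv
    ...   | no  v≢r  = record { vertex = vertex ; above = ≼-trans (≼-parent v) above′ ; holds = holds ; lowest = lowest′ }
      where
      open LowestAncestor (go (p v) (above (≢root⇒≺parent v≢r))) renaming (above to above′; lowest to lowest″)
      lowest′ : ∀ w → v ≼ w → Q w → vertex ≼ w
      lowest′ w v≼w Qw = lowest″ w (≺⇒parent≼ (v≼w , λ { refl → ¬Qv Qw })) Qw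

  lca : ∀ x y → ∃ λ w → IsLca T x y w
  lca x y = vertex , above , holds , lowest
    where open LowestAncestor (lowest-ancestor (leaf T y ≼?_) (reaches-root _) (leaf T x))

  constant-on-path : ∀ {X : Set} (f : V → X) {a b} → a ≼ b →
                     (∀ q → a ≼ q → q ≺ b → f (p q) ≡ f q) → f a ≡ f b
  constant-on-path f {a} {b} = go a (≻-wellFounded a)
    where
    go : ∀ a → Acc (flip _≺_) a → a ≼ b → (∀ q → a ≼ q → q ≺ b → f (p q) ≡ f q) → f a ≡ f b
    go a (acc above) a≼b constant-edge with a ≟ b
    ... | yes refl = refl
    ... | no  a≢b  = trans (sym (constant-edge a ≼-refl a≺b))
                       (go (p a) (above (≢root⇒≺parent (≺⇒≢root a≺b))) (≺⇒parent≼ a≺b)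
                           (λ q pa≼q → constant-edge q (≼-trans (≼-parent a) pa≼q)))
      where
      a≺b : a ≺ b
      a≺b = a≼b , a≢b

  descend-to-leaf : (Q : V → Set) → (∀ w → Q w → IsInner T w → ∃ λ c → IsChild T c w × Q c) →
                    ∀ v → Q v → ∃ λ x → leaf T x ≼ v × Q (leaf T x)
  descend-to-leaf Q step v = go v (≺-wellFounded v)
    where
    go : ∀ v → Acc _≺_ v → Q v → ∃ λ x → leaf T x ≼ v × Q (leaf T x)
    go v (acc below) Qv with inner? T v
    ... | no ¬inner with noChild-leaf v ¬inner
    ...   | x , refl = x , ≼-refl , Qv
    go v (acc below) Qv | yes inner with step v Qv inner
    ...   | c , c-child , Qc with go c (below (child-≺ c-child)) Qc
    ...     | x , x≼c , Qx = x , ≼-trans x≼c (child-≼ c-child) , Qx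

  leaf-below : ∀ v → ∃ λ x → leaf T x ≼ v
  leaf-below v with descend-to-leaf (λ _ → ⊤) (λ _ _ (c , c-child) → c , c-child , tt) v tt
  ... | x , x≼v , _ = x , x≼v

  separating-leaf : ∀ {a b} → a ≺ b → ∃ λ x → leaf T x ≼ b × ¬ (leaf T x ≼ a)
  separating-leaf a≺b with child-on-path a≺b
  ... | c , c-child , a≼c with other-child c-child
  ...   | c′ , c′-child , c≢c′ with leaf-below c′
  ...     | x , x≼c′ = x , ≼-trans x≼c′ (child-≼ c′-child) ,
                       λ x≼a → c≢c′ (children-disjoint c-child c′-child (≼-trans x≼a a≼c) x≼c′)

  leaves⊆⇒≼ : ∀ {a b} → (∀ x → leaf T x ≼ a → leaf T x ≼ b) → a ≼ b
  leaves⊆⇒≼ {a} {b} a⊆b with leaf-below a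
  ... | z , z≼a with ≼-total z≼a (a⊆b z z≼a)
  ...   | inj₁ a≼b = a≼b
  ...   | inj₂ b≼a with b ≟ a
  ...     | yes refl = ≼-refl
  ...     | no  b≢a with separating-leaf (b≼a , b≢a)
  ...       | x , x≼a , x⋠b = contradiction (a⊆b x x≼a) x⋠b

  clusters-unique : ∀ {u v A} → ClusterOf T u A → ClusterOf T v A → u ≡ v
  clusters-unique u-cluster v-cluster =
    ≼-antisym (leaves⊆⇒≼ λ x x≼u → proj₁ (v-cluster x) (proj₂ (u-cluster x) x≼u))
              (leaves⊆⇒≼ λ x x≼v → proj₁ (u-cluster x) (proj₂ (v-cluster x) x≼v))

  leafSet : V → Subset n
  leafSet v = tabulate (λ x → does (leaf T x ≼? v))

  leafSet-isCluster : ∀ v → ClusterOf T v (leafSet v)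
  leafSet-isCluster v = ∈-tabulate-does (_≼? v ∘ leaf T)

-- Comparing trees through their leaf sets

SameLeaves : ∀ {n} (T₁ T₂ : RawTree n) → Vtx T₁ → Vtx T₂ → Set
SameLeaves T₁ T₂ u v = ∀ x → Below T₁ (leaf T₁ x) u ↔ Below T₂ (leaf T₂ x) v

cluster-≗ : ∀ {n} (T : RawTree n) {v A B} → ClusterOf T v A → ClusterOf T v B → ∀ x → (x ∈ A) ↔ (x ∈ B)
cluster-≗ T A-cluster B-cluster x = proj₂ (B-cluster x) ∘ proj₁ (A-cluster x) , proj₂ (A-cluster x) ∘ proj₁ (B-cluster x)

module _ {n} (T₁ T₂ : RawTree n) where

  sameLeaves-sym : ∀ {u v} → SameLeaves T₁ T₂ u v → SameLeaves T₂ T₁ v u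
  sameLeaves-sym u≈v x = proj₂ (u≈v x) , proj₁ (u≈v x)

  clusters⇒sameLeaves : ∀ {u v A} → ClusterOf T₁ u A → ClusterOf T₂ v A → SameLeaves T₁ T₂ u v
  clusters⇒sameLeaves u-cluster v-cluster x =
    proj₁ (v-cluster x) ∘ proj₂ (u-cluster x) , proj₁ (u-cluster x) ∘ proj₂ (v-cluster x)

  sameLeaves-cluster : ∀ {u v A} → ClusterOf T₁ u A → SameLeaves T₁ T₂ u v → ClusterOf T₂ v A
  sameLeaves-cluster u-cluster u≈v x = proj₁ (u≈v x) ∘ proj₁ (u-cluster x) , proj₂ (u-cluster x) ∘ proj₂ (u≈v x)

module _ {n : ℕ} (T₁ : RawTree n) (P₁ : IsPhylo T₁) (T₂ : RawTree n) (P₂ : IsPhylo T₂) where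
  private
    module A = Ancestry T₁ P₁
    module B = Ancestry T₂ P₂

  sameLeaves-≼ : ∀ {u u′ v v′} → SameLeaves T₁ T₂ u u′ → SameLeaves T₁ T₂ v v′ → A._≼_ u v → B._≼_ u′ v′
  sameLeaves-≼ u≈u′ v≈v′ u≼v = B.leaves⊆⇒≼ λ x x≼u′ → proj₁ (v≈v′ x) (A.≼-trans (proj₂ (u≈u′ x) x≼u′) u≼v)

  sameLeaves-≼⁻ : ∀ {u u′ v v′} → SameLeaves T₁ T₂ u u′ → SameLeaves T₁ T₂ v v′ → B._≼_ u′ v′ → A._≼_ u v
  sameLeaves-≼⁻ u≈u′ v≈v′ u′≼v′ = A.leaves⊆⇒≼ λ x x≼u → proj₂ (v≈v′ x) (B.≼-trans (proj₁ (u≈u′ x) x≼u) u′≼v′)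

  sameLeaves-≺ : ∀ {u u′ v v′} → SameLeaves T₁ T₂ u u′ → SameLeaves T₁ T₂ v v′ → A._≺_ u v → B._≺_ u′ v′
  sameLeaves-≺ {u′ = u′} u≈u′ v≈v′ (u≼v , u≢v) =
    sameLeaves-≼ u≈u′ v≈v′ u≼v ,
    λ u′≡v′ → u≢v (A.≼-antisym u≼v (sameLeaves-≼⁻ v≈v′ u≈u′ (B.≼-reflexive (sym u′≡v′))))

  sameLeaves-inner : ∀ {v v′} → SameLeaves T₁ T₂ v v′ → IsInner T₁ v → IsInner T₂ v′
  sameLeaves-inner {v} {v′} v≈v′ (d , d-child) with inner? T₂ v′
  ... | yes inner = inner
  ... | no ¬inner with B.noChild-leaf v′ ¬inner | A.separating-leaf (A.child-≺ d-child) | A.leaf-below d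
  ...   | y , refl | x , x≼v , x⋠d | z , z≼d = contradiction (subst (λ w → A._≼_ (leaf T₁ w) d) z≡x z≼d) x⋠d
    where
    is-y : ∀ w → A._≼_ (leaf T₁ w) v → w ≡ y
    is-y w w≼v = B.leaf-injective w y (B.≼leaf⇒≡leaf (proj₁ (v≈v′ w) w≼v))
    z≡x : z ≡ x
    z≡x = trans (is-y z (A.≼-trans z≼d (A.child-≼ d-child))) (sym (is-y x x≼v))

module Contraction {n : ℕ} (T : RawTree n) (P : IsPhylo T) {Keep : Vtx T → Set} (Keep? : Decidable Keep)
                   (keep-root : Keep (root T)) (keep-leaf : ∀ x → Keep (leaf T x)) where
  open Ancestry T P

  private
    p = parent T
    r = root T

  keptAncestor : ∀ v → LowestAncestor Keep v
  keptAncestor = lowest-ancestor Keep? keep-root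

  up : V → V
  up v = LowestAncestor.vertex (keptAncestor v)

  ≼-up : ∀ v → v ≼ up v
  ≼-up v = LowestAncestor.above (keptAncestor v)

  up-kept : ∀ v → Keep (up v)
  up-kept v = LowestAncestor.holds (keptAncestor v)

  up-lowest : ∀ v w → v ≼ w → Keep w → up v ≼ w
  up-lowest v = LowestAncestor.lowest (keptAncestor v)

  T′ : RawTree n
  T′ = record
    { size   = count Keep?
    ; root   = index Keep? r keep-root
    ; parent = λ i → index Keep? (up (p (embed Keep? i))) (up-kept _)
    ; leaf   = λ x → index Keep? (leaf T x) (keep-leaf x)
    }

  private
    p′ = parent T′
    r′ = root T′

  e : Vtx T′ → V
  e = embed Keep?

  e-parent : ∀ i → e (p′ i) ≡ up (p (e i))
  e-parent i = embed-index Keep? _ _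

  e-root : e r′ ≡ r
  e-root = embed-index Keep? _ _

  e-leaf : ∀ x → e (leaf T′ x) ≡ leaf T x
  e-leaf x = embed-index Keep? _ _

  e-injective : ∀ {i j} → e i ≡ e j → i ≡ j
  e-injective = embed-injective Keep?

  e≡root⇒≡root′ : ∀ {i} → e i ≡ r → i ≡ r′
  e≡root⇒≡root′ eᵢ≡r = e-injective (trans eᵢ≡r (sym e-root))

  e-kept : ∀ i → Keep (e i)
  e-kept = embed-kept Keep?

  ≼-e-parent : ∀ i → e i ≼ e (p′ i)
  ≼-e-parent i = subst (e i ≼_) (sym (e-parent i)) (≼-trans (≼-parent (e i)) (≼-up _))

  ≢root⇒≺e-parent : ∀ i → e i ≢ r → e i ≺ e (p′ i)
  ≢root⇒≺e-parent i eᵢ≢r = ≼-e-parent i , λ eq → proj₂ (≢root⇒≺parent eᵢ≢r) (≼-antisym (≼-parent (e i))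
                              (subst (p (e i) ≼_) (trans (sym (e-parent i)) (sym eq)) (≼-up _)))

  Below′⇒≼ : ∀ {i j} → Below T′ i j → e i ≼ e j
  Below′⇒≼ {i} (k , refl) = go k
    where
    go : ∀ k → e i ≼ e (iterate p′ k i)
    go zero    = ≼-refl
    go (suc k) = ≼-trans (go k) (≼-e-parent (iterate p′ k i))

  ≺⇒e-parent≼ : ∀ {i j} → e i ≺ e j → e (p′ i) ≼ e j
  ≺⇒e-parent≼ {i} {j} eᵢ≺eⱼ = subst (_≼ e j) (sym (e-parent i)) (up-lowest _ _ (≺⇒parent≼ eᵢ≺eⱼ) (e-kept j))

  ≼⇒Below′ : ∀ {i j} → e i ≼ e j → Below T′ i j
  ≼⇒Below′ {i} {j} = go i (≻-wellFounded (e i))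
    where
    go : ∀ i → Acc (flip _≺_) (e i) → e i ≼ e j → Below T′ i j
    go i (acc above) eᵢ≼eⱼ with i ≟ j
    ... | yes refl = zero , refl
    ... | no  i≢j  =
      let eᵢ≺eⱼ = eᵢ≼eⱼ , i≢j ∘ e-injective
          (k , p′ᵏp′ᵢ≡j) = go (p′ i) (above (≢root⇒≺e-parent i (≺⇒≢root eᵢ≺eⱼ))) (≺⇒e-parent≼ eᵢ≺eⱼ)
      in suc k , trans (iterate-suc p′ k i) p′ᵏp′ᵢ≡j

  up-kept-id : ∀ {v} → Keep v → up v ≡ v
  up-kept-id {v} kept = ≼-antisym (up-lowest v v ≼-refl kept) (≼-up v)

  root-fix′ : p′ r′ ≡ r′
  root-fix′ = e-injective (begin
    e (p′ r′)      ≡⟨ e-parent r′ ⟩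
    up (p (e r′))  ≡⟨ cong (up ∘ p) e-root ⟩
    up (p r)       ≡⟨ cong up root-fix ⟩
    up r           ≡⟨ up-kept-id keep-root ⟩
    r              ≡⟨ sym e-root ⟩
    e r′           ∎)
    where open ≡-Reasoning

  root-unique′ : ∀ i → p′ i ≡ i → i ≡ r′
  root-unique′ i pᵢ≡i with e i ≟ r
  ... | yes eᵢ≡r = e≡root⇒≡root′ eᵢ≡r
  ... | no  eᵢ≢r = contradiction (cong e pᵢ≡i) (proj₂ (≢root⇒≺e-parent i eᵢ≢r) ∘ sym)

  child′⇒≺ : ∀ {c i} → IsChild T′ c i → e c ≺ e i
  child′⇒≺ {c} (c≢r′ , refl) = ≢root⇒≺e-parent c (c≢r′ ∘ e≡root⇒≡root′)

  leaf≼⇒Below′ : ∀ {x i} → leaf T x ≼ e i → Below T′ (leaf T′ x) i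
  leaf≼⇒Below′ {x} x≼eᵢ = ≼⇒Below′ (subst (_≼ _) (sym (e-leaf x)) x≼eᵢ)

  Below′⇒leaf≼ : ∀ {x i} → Below T′ (leaf T′ x) i → leaf T x ≼ e i
  Below′⇒leaf≼ {x} x≼′i = subst (_≼ _) (e-leaf x) (Below′⇒≼ x≼′i)

  child′-through : ∀ {c i x} → IsChild T c (e i) → leaf T x ≼ c →
                   ∃ λ d → IsChild T′ d i × Below T′ (leaf T′ x) d
  child′-through {c} {i} {x} c-child x≼c with leaf≼⇒Below′ {x} {i} (≼-trans x≼c (child-≼ c-child))
  ... | k , pᵏx≡i = child-on-iterated-path T′ root-fix′ k _ _ pᵏx≡i λ x≡i →
          child-≢ c-child (≼-antisym (child-≼ c-child) (subst (_≼ c) (trans (sym (e-leaf x)) (cong e x≡i)) x≼c))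

  inner′⇒inner : ∀ {i} → IsInner T′ i → IsInner T (e i)
  inner′⇒inner (c , c-child) with child-on-path (child′⇒≺ c-child)
  ... | c₀ , c₀-child , _ = c₀ , c₀-child

  isPhylo′ : IsPhylo T′
  isPhylo′ = record
    { root-fix       = root-fix′
    ; root-unique    = root-unique′
    ; reaches-root   = λ i → ≼⇒Below′ (subst (e i ≼_) (sym e-root) (reaches-root (e i)))
    ; leaf-injective = λ x y eq → leaf-injective x y (trans (sym (e-leaf x)) (trans (cong e eq) (e-leaf y)))
    ; leaf-noChild   = leaf-noChild′
    ; noChild-leaf   = noChild-leaf′
    ; phylogenetic   = phylogenetic′
    }
    where
    leaf-noChild′ : ∀ x → ¬ IsInner T′ (leaf T′ x)
    leaf-noChild′ x (c , c-child) with child′⇒≺ c-child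
    ... | eᶜ≼x , eᶜ≢x = eᶜ≢x (trans (≼leaf⇒≡leaf (subst (e c ≼_) (e-leaf x) eᶜ≼x)) (sym (e-leaf x)))

    noChild-leaf′ : ∀ i → ¬ IsInner T′ i → ∃ λ x → leaf T′ x ≡ i
    noChild-leaf′ i ¬inner with inner? T (e i)
    ... | no ¬innerₑ with noChild-leaf (e i) ¬innerₑ
    ...   | x , x≡eᵢ = x , e-injective (trans (e-leaf x) x≡eᵢ)
    noChild-leaf′ i ¬inner | yes (c , c-child) with leaf-below c
    ...   | z , z≼c with child′-through c-child z≼c
    ...     | d , d-child , _ = contradiction (d , d-child) ¬inner

    phylogenetic′ : ∀ i → IsInner T′ i → ∃₂ λ u w → (u ≢ w) × IsChild T′ u i × IsChild T′ w i
    phylogenetic′ i inner with phylogenetic (e i) (inner′⇒inner inner)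
    ... | a , b , a≢b , a-child , b-child with leaf-below a | leaf-below b
    ...   | x , x≼a | y , y≼b with child′-through a-child x≼a | child′-through b-child y≼b
    ...     | d₁ , d₁-child , x≼′d₁ | d₂ , d₂-child , y≼′d₂ = d₁ , d₂ , d₁≢d₂ , d₁-child , d₂-child
      where
      d₁≢d₂ : d₁ ≢ d₂
      d₁≢d₂ refl = proj₂ (child′⇒≺ d₁-child) (≼-antisym (proj₁ (child′⇒≺ d₁-child))
                     (separated⇒parent≼ a-child b-child a≢b x≼a y≼b (Below′⇒leaf≼ x≼′d₁) (Below′⇒leaf≼ y≼′d₂)))

  cluster′↔cluster : ∀ i A → ClusterOf T′ i A ↔ ClusterOf T (e i) A
  cluster′↔cluster i A =
    (λ A-cluster x → (Below′⇒leaf≼ ∘ proj₁ (A-cluster x)) , (proj₂ (A-cluster x) ∘ leaf≼⇒Below′)) ,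
    (λ A-cluster x → (leaf≼⇒Below′ ∘ proj₁ (A-cluster x)) , (proj₂ (A-cluster x) ∘ Below′⇒leaf≼))

  kept⇒InH′ : ∀ {v A} → Keep v → ClusterOf T v A → InH T′ A
  kept⇒InH′ {v} kept v-cluster = index Keep? v kept ,
    proj₂ (cluster′↔cluster _ _) (subst (λ w → ClusterOf T w _) (sym (embed-index Keep? v kept)) v-cluster)

  InH′⇒kept : ∀ {A} → InH T′ A → ∃ λ v → Keep v × ClusterOf T v A
  InH′⇒kept {A} (i , i-cluster) = e i , e-kept i , proj₁ (cluster′↔cluster i A) i-cluster

  lca′-is-kept-ancestor : ∀ {x y i w} → IsLca T′ x y i → IsLca T x y w → e i ≡ up w
  lca′-is-kept-ancestor {x} {y} {i} {w} (x≼′i , y≼′i , lowest′) (x≼w , y≼w , lowest) =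
    ≼-antisym eᵢ≼up (up-lowest w (e i) w≼eᵢ (e-kept i))
    where
    w≼eᵢ : w ≼ e i
    w≼eᵢ = lowest (e i) (Below′⇒leaf≼ x≼′i) (Below′⇒leaf≼ y≼′i)
    j : Vtx T′
    j = index Keep? (up w) (up-kept w)
    eⱼ≡up : e j ≡ up w
    eⱼ≡up = embed-index Keep? _ _
    eᵢ≼up : e i ≼ up w
    eᵢ≼up = subst (e i ≼_) eⱼ≡up (Below′⇒≼ (lowest′ j
              (leaf≼⇒Below′ (subst (_ ≼_) (sym eⱼ≡up) (≼-trans x≼w (≼-up w))))
              (leaf≼⇒Below′ (subst (_ ≼_) (sym eⱼ≡up) (≼-trans y≼w (≼-up w))))))

  constant-up-to-kept : ∀ {X : Set} (f : V → X) → (∀ q → ¬ Keep q → f (p q) ≡ f q) → ∀ v → f v ≡ f (up v)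
  constant-up-to-kept f constant-edge v = constant-on-path f (≼-up v) λ q v≼q q≺up →
    constant-edge q (LowestAncestor.strictly-below⇒¬holds (keptAncestor v) q v≼q q≺up)

  contraction-explainsΔ : ∀ {m} (t : V → Fin m) {δ : Fin n → Fin n → Fin m} →
                          (∀ q → ¬ Keep q → t (p q) ≡ t q) → ExplainsΔ T t δ → ExplainsΔ T′ (t ∘ e) δ
  contraction-explainsΔ t constant-edge explains x y x≢y i i-lca with lca x y
  ... | w , w-lca = begin
    t (e i)   ≡⟨ cong t (lca′-is-kept-ancestor i-lca w-lca) ⟩
    t (up w)  ≡⟨ sym (constant-up-to-kept t constant-edge w) ⟩
    t w       ≡⟨ explains x y x≢y w w-lca ⟩
    _         ∎
    where open ≡-Reasoning

-- The sets U_{¬m}[y]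

IsU? : ∀ {n k} (ε : Fin n → Fin n → Subset k) m y (A : Subset n) → Dec (IsU ε m y A)
IsU? ε m y A = Finₚ.all? λ x → ↔-dec (x ∈? A) ((x ≟ y) ⊎-dec (¬? (x ≟ y) ×-dec ¬? (m ∈? ε x y)))
  where
  ↔-dec : ∀ {X Y : Set} → Dec X → Dec Y → Dec (X ↔ Y)
  ↔-dec X? Y? = (X? →-dec Y?) ×-dec (Y? →-dec X?)

module _ {n k : ℕ} (ε : Fin n → Fin n → Subset k) {m : Fin k} {y : Fin n} {A : Subset n} (A-isU : IsU ε m y A) where

  y∈U : y ∈ A
  y∈U = proj₂ (A-isU y) (inj₁ refl)

  ∈U⇒∉ε : ∀ {x} → x ≢ y → x ∈ A → m ∉ ε x y
  ∈U⇒∉ε x≢y x∈A with proj₁ (A-isU _) x∈A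
  ... | inj₁ x≡y       = contradiction x≡y x≢y
  ... | inj₂ (_ , m∉ε) = m∉ε

  ∉U⇒∈ε : ∀ {x} → x ∉ A → m ∈ ε x y
  ∉U⇒∈ε {x} x∉A with m ∈? ε x y
  ... | yes m∈ε = m∈ε
  ... | no  m∉ε with x ≟ y
  ...   | yes x≡y = contradiction (proj₂ (A-isU x) (inj₁ x≡y)) x∉A
  ...   | no  x≢y = contradiction (proj₂ (A-isU x) (inj₂ (x≢y , m∉ε))) x∉A

  IsU-⊆ : ∀ {B} → IsU ε m y B → ∀ x → x ∈ A → x ∈ B
  IsU-⊆ B-isU x x∈A = proj₂ (B-isU x) (proj₁ (A-isU x) x∈A)

  IsU-resp : ∀ {B} → (∀ x → (x ∈ A) ↔ (x ∈ B)) → IsU ε m y B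
  IsU-resp A≗B x = (proj₁ (A-isU x) ∘ proj₂ (A≗B x)) , (proj₁ (A≗B x) ∘ proj₂ (A-isU x))

module ExplainedΕ {n k : ℕ} (T : RawTree n) (P : IsPhylo T) (lab : Vtx T → Subset k)
                  (ε : Fin n → Fin n → Subset k) (explains : ExplainsΕ T lab ε) where
  open Ancestry T P

  RootOrLabelled : Fin k → V → Set
  RootOrLabelled m w = w ≡ root T ⊎ m ∈ lab w

  uAncestor : ∀ y m → LowestAncestor (RootOrLabelled m) (leaf T y)
  uAncestor y m = lowest-ancestor (λ w → (w ≟ root T) ⊎-dec (m ∈? lab w)) (inj₁ refl) (leaf T y)

  uVertex : Fin n → Fin k → V
  uVertex y m = LowestAncestor.vertex (uAncestor y m)

  uVertex-leaves : ∀ {x y} m → x ≢ y → (leaf T x ≼ uVertex y m) ↔ (m ∉ ε x y)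
  uVertex-leaves {x} {y} m x≢y = ≼⇒∉ , ∉⇒≼
    where
    open LowestAncestor (uAncestor y m)
    ≼⇒∉ : leaf T x ≼ vertex → m ∉ ε x y
    ≼⇒∉ x≼c m∈ε with lca x y
    ... | w , w-lca@(x≼w , y≼w , w-lowest) with proj₁ (explains x y x≢y w w-lca m) m∈ε
    ...   | u , y≼u , u≼w , u≢w , m∈lab = strictly-below⇒¬holds u y≼u (≼-trans u≼w w≼c , u≢c) (inj₂ m∈lab)
      where
      w≼c : w ≼ vertex
      w≼c = w-lowest vertex x≼c above
      u≢c : u ≢ vertex
      u≢c refl = u≢w (≼-antisym u≼w w≼c)
    ∉⇒≼ : m ∉ ε x y → leaf T x ≼ vertex
    ∉⇒≼ m∉ε = decidable-stable (leaf T x ≼? vertex) λ x⋠c → m∉ε (⋠⇒∈ε x⋠c (lca x y))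
      where
      ⋠⇒∈ε : ¬ (leaf T x ≼ vertex) → (∃ λ w → IsLca T x y w) → m ∈ ε x y
      ⋠⇒∈ε x⋠c (w , w-lca@(x≼w , y≼w , _)) with ≼-total above y≼w
      ... | inj₂ w≼c = contradiction (≼-trans x≼w w≼c) x⋠c
      ... | inj₁ c≼w with vertex ≟ w
      ...   | yes refl = contradiction x≼w x⋠c
      ...   | no  c≢w with holds
      ...     | inj₁ c≡r     = contradiction c≡r (≺⇒≢root (c≼w , c≢w))
      ...     | inj₂ m∈lab-c = proj₂ (explains x y x≢y w w-lca m) (vertex , above , c≼w , c≢w , m∈lab-c)

  uVertex-isU : ∀ y m → IsU ε m y (leafSet (uVertex y m))
  uVertex-isU y m x = ∈⇒ , ⇒∈
    where
    open LowestAncestor (uAncestor y m)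
    ∈⇒ : x ∈ leafSet vertex → (x ≡ y) ⊎ ((x ≢ y) × (m ∉ ε x y))
    ∈⇒ x∈ with x ≟ y
    ... | yes x≡y = inj₁ x≡y
    ... | no  x≢y = inj₂ (x≢y , proj₁ (uVertex-leaves m x≢y) (proj₁ (leafSet-isCluster vertex x) x∈))
    ⇒∈ : (x ≡ y) ⊎ ((x ≢ y) × (m ∉ ε x y)) → x ∈ leafSet vertex
    ⇒∈ (inj₁ refl)         = proj₂ (leafSet-isCluster vertex x) above
    ⇒∈ (inj₂ (x≢y , m∉ε)) = proj₂ (leafSet-isCluster vertex x) (proj₂ (uVertex-leaves m x≢y) m∉ε)

  uVertex-cluster : ∀ {y m A} → IsU ε m y A → ClusterOf T (uVertex y m) A
  uVertex-cluster {y} {m} A-isU x =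
    (proj₁ (leafSet-isCluster _ x) ∘ IsU-⊆ ε A-isU (uVertex-isU y m) x) ,
    (IsU-⊆ ε (uVertex-isU y m) A-isU x ∘ proj₂ (leafSet-isCluster _ x))

  InHε⇒InH : ∀ {A} → InHε ε A → InH T A
  InHε⇒InH (inj₁ (y , m , A-isU)) = uVertex y m , uVertex-cluster A-isU
  InHε⇒InH (inj₂ (inj₁ A-full))   = root T , λ x → (λ _ → reaches-root _) , (λ _ → A-full x)
  InHε⇒InH (inj₂ (inj₂ (y , A≡y))) = leaf T y , λ x →
    (λ x∈A → ≼-reflexive (cong (leaf T) (proj₁ (A≡y x) x∈A))) ,
    (λ x≼y → proj₂ (A≡y x) (leaf-injective x y (≼leaf⇒≡leaf x≼y)))

  U-cluster-labelled : ∀ {c y m A} → ClusterOf T c A → IsU ε m y A → c ≢ root T → m ∈ lab c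
  U-cluster-labelled {y = y} {m} c-cluster A-isU c≢r with clusters-unique c-cluster (uVertex-cluster A-isU)
  ... | refl with LowestAncestor.holds (uAncestor y m)
  ...   | inj₁ c≡r     = contradiction c≡r c≢r
  ...   | inj₂ m∈lab-c = m∈lab-c

  U-nested : ∀ {m y y′ A B} → IsU ε m y′ A → y ∈ A → IsU ε m y B → ∀ x → x ∈ B → x ∈ A
  U-nested {m} {y} {y′} A-isU y∈A B-isU x x∈B =
    proj₂ (uVertex-cluster A-isU x) (≼-trans (proj₁ (uVertex-cluster B-isU x) x∈B) cᵧ≼cᵧ′)
    where
    open LowestAncestor (uAncestor y m)
    y≼cᵧ′ : leaf T y ≼ uVertex y′ m
    y≼cᵧ′ = proj₁ (uVertex-cluster A-isU y) y∈A
    cᵧ≼cᵧ′ : vertex ≼ uVertex y′ m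
    cᵧ≼cᵧ′ = lowest _ y≼cᵧ′ (LowestAncestor.holds (uAncestor y′ m))

module _ {n k : ℕ} (ε : Fin n → Fin n → Subset k)
         (U-nested : ∀ {m y y′ A B} → IsU ε m y′ A → y ∈ A → IsU ε m y B → ∀ x → x ∈ B → x ∈ A)
         (S : RawTree n) (S-phylo : IsPhylo S) (lab : Vtx S → Subset k) where
  open Ancestry S S-phylo

  U-labelled⇒explainsΕ : (∀ y m → ∃ λ c → IsU ε m y (leafSet c)) →
                         (∀ v → v ≢ root S → ∀ m → (m ∈ lab v) ↔ (∃ λ y → IsU ε m y (leafSet v))) →
                         ExplainsΕ S lab ε
  U-labelled⇒explainsΕ U-vertex lab-spec x y x≢y w (x≼w , y≼w , w-lowest) m = ∈ε⇒edge , edge⇒∈ε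
    where
    ∈ε⇒edge : m ∈ ε x y → ∃ λ u → leaf S y ≼ u × u ≼ w × (u ≢ w) × (m ∈ lab u)
    ∈ε⇒edge m∈ε with U-vertex y m
    ... | c , c-isU = c , y≼c , c≼w , c≢w , proj₂ (lab-spec c (≺⇒≢root (c≼w , c≢w)) m) (y , c-isU)
      where
      y≼c : leaf S y ≼ c
      y≼c = proj₁ (leafSet-isCluster c y) (y∈U ε c-isU)
      x⋠c : ¬ (leaf S x ≼ c)
      x⋠c x≼c = ∈U⇒∉ε ε c-isU x≢y (proj₂ (leafSet-isCluster c x) x≼c) m∈ε
      c≼w : c ≼ w
      c≼w with ≼-total y≼c y≼w
      ... | inj₁ c≼w = c≼w
      ... | inj₂ w≼c = contradiction (≼-trans x≼w w≼c) x⋠c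
      c≢w : c ≢ w
      c≢w refl = x⋠c x≼w
    edge⇒∈ε : (∃ λ u → leaf S y ≼ u × u ≼ w × (u ≢ w) × (m ∈ lab u)) → m ∈ ε x y
    edge⇒∈ε (u , y≼u , u≼w , u≢w , m∈lab) with proj₁ (lab-spec u (≺⇒≢root (u≼w , u≢w)) m) m∈lab | U-vertex y m
    ... | _ , u-isU | c , c-isU = ∉U⇒∈ε ε c-isU λ x∈c →
          x⋠u (proj₁ (leafSet-isCluster u x) (U-nested u-isU (proj₂ (leafSet-isCluster u y) y≼u) c-isU x x∈c))
      where
      x⋠u : ¬ (leaf S x ≼ u)
      x⋠u x≼u = u≢w (≼-antisym u≼w (w-lowest u x≼u y≼u))

-- Trees explaining δ

-- Exactly these vertices survive in the discriminating tree of δ.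
Distinguished : ∀ {n m} (T : RawTree n) → (Vtx T → Fin m) → Vtx T → Set
Distinguished T t u = u ≡ root T ⊎ ¬ IsInner T u ⊎ t (parent T u) ≢ t u

distinguished? : ∀ {n m} (T : RawTree n) (t : Vtx T → Fin m) → Decidable (Distinguished T t)
distinguished? T t u = (u ≟ root T) ⊎-dec (¬? (inner? T u) ⊎-dec ¬? (t (parent T u) ≟ t u))

discriminating⇒distinguished : ∀ {n m} (T : RawTree n) (t : Vtx T → Fin m) → Discriminating T t → ∀ v → Distinguished T t v
discriminating⇒distinguished T t disc v with v ≟ root T | inner? T v
... | yes v≡r | _         = inj₁ v≡r
... | no  _   | no ¬inner = inj₂ (inj₁ ¬inner)
... | no  v≢r | yes inner = inj₂ (inj₂ (disc v v≢r inner))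

distinguished-inner⇒change : ∀ {n m} (T : RawTree n) (t : Vtx T → Fin m) {u} → Distinguished T t u →
                             u ≢ root T → IsInner T u → t (parent T u) ≢ t u
distinguished-inner⇒change T t (inj₁ u≡r)          u≢r _     = contradiction u≡r u≢r
distinguished-inner⇒change T t (inj₂ (inj₁ ¬inner)) _   inner = contradiction inner ¬inner
distinguished-inner⇒change T t (inj₂ (inj₂ change)) _   _     = change

module ExplainedΔ {n m : ℕ} {δ : Fin n → Fin n → Fin m} (T : RawTree n) (P : IsPhylo T)
                  (t : Vtx T → Fin m) (explains : ExplainsΔ T t δ) where
  open Ancestry T P

  split-pair : ∀ {u α} → t u ≢ α → (Pr : Fin n → Set) → Decidable Pr →
               ∀ {a₀ b₀} → leaf T a₀ ≼ u → leaf T b₀ ≼ u → Pr a₀ → ¬ Pr b₀ →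
               ∃₂ λ a b → leaf T a ≼ u × leaf T b ≼ u × Pr a × ¬ Pr b × δ a b ≢ α
  split-pair {u} tᵤ≢α Pr Pr? {a₀} {b₀} a₀≼u b₀≼u Pr-a₀ ¬Pr-b₀ with lca a₀ b₀
  ... | h , h-lca@(a₀≼h , b₀≼h , h-lowest) with h ≟ u
  ...   | yes refl = a₀ , b₀ , a₀≼u , b₀≼u , Pr-a₀ , ¬Pr-b₀ , tᵤ≢α ∘ trans (explains a₀ b₀ (≢-by Pr-a₀ ¬Pr-b₀) h h-lca)
  ...   | no  h≢u with child-on-path (h-lowest u a₀≼u b₀≼u , h≢u)
  ...     | c₁ , c₁-child , h≼c₁ with other-child c₁-child
  ...       | c₂ , c₂-child , c₁≢c₂ with leaf-below c₂
  ...         | z , z≼c₂ with Pr? z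
  ...           | yes Pr-z = z , b₀ , ≼-trans z≼c₂ (child-≼ c₂-child) , b₀≼u , Pr-z , ¬Pr-b₀ ,
                  tᵤ≢α ∘ trans (explains z b₀ (≢-by Pr-z ¬Pr-b₀) u
                                  (lca-of-separated c₂-child c₁-child (c₁≢c₂ ∘ sym) z≼c₂ (≼-trans b₀≼h h≼c₁)))
  ...           | no ¬Pr-z = a₀ , z , a₀≼u , ≼-trans z≼c₂ (child-≼ c₂-child) , Pr-a₀ , ¬Pr-z ,
                  tᵤ≢α ∘ trans (explains a₀ z (≢-by Pr-a₀ ¬Pr-z) u
                                  (lca-of-separated c₁-child c₂-child c₁≢c₂ (≼-trans a₀≼h h≼c₁) z≼c₂))

  module _ {X Y : Fin n → Set} (X? : Decidable X) {α : Fin m}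
           (across : ∀ {x w} → X x → Y w → ¬ X w → δ x w ≡ α)
           (split : (Pr : Fin n → Set) → Decidable Pr → ∀ {a₀ b₀} → X a₀ → X b₀ → Pr a₀ → ¬ Pr b₀ →
                    ∃₂ λ a b → X a × X b × Pr a × ¬ Pr b × δ a b ≢ α)
           {x₀ : Fin n} (X-x₀ : X x₀) where

    private
      e : ℕ → V
      e j = iterate (parent T) j (leaf T x₀)

    -- Descend from e j towards x₀ while X stays below; an extra leaf w below e j but outside X forces t (e j) ≡ α,
    -- which the split pair of X at the next vertex on the path contradicts.
    recognise : ∀ j → (∀ x → X x → leaf T x ≼ e j) → (∀ x → leaf T x ≼ e j → Y x) →
                ∃ λ v → ∀ x → X x ↔ (leaf T x ≼ v)
    recognise j X⊆ ⊆Y with Finₚ.any? (λ w → (leaf T w ≼? e j) ×-dec ¬? (X? w))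
    ... | no ¬extra = e j , λ x → X⊆ x , λ x≼e → decidable-stable (X? x) λ ¬Xx → ¬extra (x , x≼e , ¬Xx)
    recognise zero    X⊆ ⊆Y | yes (w , w≼x₀ , ¬Xw) =
      contradiction (subst X (sym (leaf-injective w x₀ (≼leaf⇒≡leaf w≼x₀))) X-x₀) ¬Xw
    recognise (suc j) X⊆ ⊆Y | yes (w , w≼e , ¬Xw) with e j ≟ root T
    ... | yes eⱼ≡r = recognise j (λ x Xx → subst (leaf T x ≼_) e≡eⱼ (X⊆ x Xx))
                                 (λ x x≼eⱼ → ⊆Y x (subst (leaf T x ≼_) (sym e≡eⱼ) x≼eⱼ))
      where
      e≡eⱼ : e (suc j) ≡ e j
      e≡eⱼ = trans (cong (parent T) eⱼ≡r) (trans root-fix (sym eⱼ≡r))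
    ... | no  eⱼ≢r = recognise j X⊆c (λ x x≼c → ⊆Y x (≼-trans x≼c (child-≼ c-child)))
      where
      c-child : IsChild T (e j) (e (suc j))
      c-child = eⱼ≢r , refl
      X⊆c : ∀ x → X x → leaf T x ≼ e j
      X⊆c x Xx = decidable-stable (leaf T x ≼? e j) λ x⋠c →
        no-split (split (λ z → leaf T z ≼ e j) (λ z → leaf T z ≼? e j) X-x₀ Xx (j , refl) x⋠c)
        where
        no-split : (∃₂ λ a b → X a × X b × leaf T a ≼ e j × ¬ (leaf T b ≼ e j) × δ a b ≢ α) → ⊥
        no-split (a , b , Xa , Xb , a≼c , b⋠c , δab≢α) = δab≢α (trans (sym t≡δab) t≡α)
          where
          t≡δab : t (e (suc j)) ≡ δ a b
          t≡δab = explains a b (≢-by a≼c b⋠c) _ (lca-across-child c-child a≼c (X⊆ b Xb) b⋠c)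
          t≡α : t (e (suc j)) ≡ α
          t≡α with leaf T w ≼? e j
          ... | yes w≼c = trans (explains b w (≢-by Xb ¬Xw) _ (lca-sym (lca-across-child c-child w≼c (X⊆ b Xb) b⋠c)))
                                (across Xb (⊆Y w w≼e) ¬Xw)
          ... | no  w⋠c = trans (explains a w (≢-by Xa ¬Xw) _ (lca-across-child c-child a≼c w≼e w⋠c))
                                (across Xa (⊆Y w w≼e) ¬Xw)

    cluster-recognition : ∀ v → (∀ x → X x → leaf T x ≼ v) → (∀ x → leaf T x ≼ v → Y x) →
                          ∃ λ v′ → ∀ x → X x ↔ (leaf T x ≼ v′)
    cluster-recognition v X⊆ ⊆Y with X⊆ x₀ X-x₀
    ... | j , refl = recognise j X⊆ ⊆Y

module _ {n m : ℕ} {δ : Fin n → Fin n → Fin m}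
         (T₁ : RawTree n) (P₁ : IsPhylo T₁) (t₁ : Vtx T₁ → Fin m) (explains₁ : ExplainsΔ T₁ t₁ δ)
         (T₂ : RawTree n) (P₂ : IsPhylo T₂) (t₂ : Vtx T₂ → Fin m) (explains₂ : ExplainsΔ T₂ t₂ δ) where
  open Ancestry T₁ P₁
  open ExplainedΔ T₁ P₁ t₁ explains₁ using (split-pair)
  open ExplainedΔ T₂ P₂ t₂ explains₂ using (cluster-recognition)

  private
    module B = Ancestry T₂ P₂
    p = parent T₁

  root-sameLeaves : SameLeaves T₁ T₂ (root T₁) (root T₂)
  root-sameLeaves x = (λ _ → B.reaches-root _) , (λ _ → reaches-root _)

  leaf-sameLeaves : ∀ y → SameLeaves T₁ T₂ (leaf T₁ y) (leaf T₂ y)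
  leaf-sameLeaves y x =
    (λ x≼y → B.≼-reflexive (cong (leaf T₂) (leaf-injective x y (≼leaf⇒≡leaf x≼y)))) ,
    (λ x≼y → ≼-reflexive (cong (leaf T₁) (B.leaf-injective x y (B.≼leaf⇒≡leaf x≼y))))

  -- Induction upwards: the cluster of u sits inside that of the next distinguished ancestor b,
  -- and every vertex strictly between them carries the label α of b.
  distinguished-cluster : ∀ u → Distinguished T₁ t₁ u → ∃ λ v → SameLeaves T₁ T₂ u v
  distinguished-cluster u = go u (≻-wellFounded u)
    where
    go : ∀ u → Acc (flip _≺_) u → Distinguished T₁ t₁ u → ∃ λ v → SameLeaves T₁ T₂ u v
    go u (acc above) distinguished with u ≟ root T₁ | inner? T₁ u
    ... | yes refl | _          = root T₂ , root-sameLeaves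
    ... | no  _    | no  ¬inner with noChild-leaf u ¬inner
    ...   | x , refl = leaf T₂ x , leaf-sameLeaves x
    go u (acc above) distinguished | no u≢r | yes inner =
      cluster-recognition (_≼? u ∘ leaf T₁) across split x₀≼u v
        (λ x x≼u → proj₁ (b≈v x) (≼-trans x≼u (proj₁ u≺b))) (λ x → proj₂ (b≈v x))
      where
      open LowestAncestor (lowest-ancestor (distinguished? T₁ t₁) (inj₁ refl) (p u)) renaming (vertex to b; above to pu≼b)
      u≺b : u ≺ b
      u≺b = ≼-trans (≼-parent u) pu≼b ,
            λ u≡b → proj₂ (≢root⇒≺parent u≢r) (≼-antisym (≼-parent u) (subst (p u ≼_) (sym u≡b) pu≼b))
      b-cluster : ∃ λ v → SameLeaves T₁ T₂ b v
      b-cluster = go b (above u≺b) holds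
      v : B.V
      v = proj₁ b-cluster
      b≈v : SameLeaves T₁ T₂ b v
      b≈v = proj₂ b-cluster
      α : Fin m
      α = t₁ b
      on-path-α : ∀ g → p u ≼ g → g ≼ b → t₁ g ≡ α
      on-path-α g pu≼g g≼b = constant-on-path t₁ g≼b λ q g≼q q≺b →
        decidable-stable (t₁ (p q) ≟ t₁ q) λ tₚ≢t → strictly-below⇒¬holds q (≼-trans pu≼g g≼q) q≺b (inj₂ (inj₂ tₚ≢t))
      tᵤ≢α : t₁ u ≢ α
      tᵤ≢α tᵤ≡α = distinguished-inner⇒change T₁ t₁ distinguished u≢r inner
                    (trans (on-path-α (p u) ≼-refl pu≼b) (sym tᵤ≡α))
      across : ∀ {x w} → leaf T₁ x ≼ u → leaf T₁ w ≼ b → ¬ (leaf T₁ w ≼ u) → δ x w ≡ α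
      across {x} {w} x≼u w≼b w⋠u with lca x w
      ... | g , g-lca@(x≼g , w≼g , g-lowest) with ≼-total x≼u x≼g
      ...   | inj₂ g≼u = contradiction (≼-trans w≼g g≼u) w⋠u
      ...   | inj₁ u≼g = trans (sym (explains₁ x w (≢-by x≼u w⋠u) g g-lca))
                               (on-path-α g (≺⇒parent≼ (u≼g , λ { refl → w⋠u w≼g })) (g-lowest b (≼-trans x≼u (proj₁ u≺b)) w≼b))
      split : (Pr : Fin n → Set) → Decidable Pr → ∀ {a₀ b₀} → leaf T₁ a₀ ≼ u → leaf T₁ b₀ ≼ u → Pr a₀ → ¬ Pr b₀ →
              ∃₂ λ a b → leaf T₁ a ≼ u × leaf T₁ b ≼ u × Pr a × ¬ Pr b × δ a b ≢ α
      split = split-pair tᵤ≢α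
      x₀ : Fin n
      x₀ = proj₁ (leaf-below u)
      x₀≼u : leaf T₁ x₀ ≼ u
      x₀≼u = proj₂ (leaf-below u)

module Necessity {n p k : ℕ} {δ : Fin n → Fin n → Fin p} {ε : Fin n → Fin n → Subset k}
    (T : RawTree n) (P : IsPhylo T) (t : Vtx T → Fin p) (lab : Vtx T → Subset k)
    (explainsΔ : ExplainsΔ T t δ) (explainsΕ : ExplainsΕ T lab ε)
    (S : RawTree n) (S-phylo : IsPhylo S) (ts : Vtx S → Fin p) (labs : Vtx S → Subset k)
    (Tδ : RawTree n) (tδ : Vtx Tδ → Fin p) (Tδ-phylo : IsPhylo Tδ) (explainsδ : ExplainsΔ Tδ tδ δ)
    (Tδ-discriminating : Discriminating Tδ tδ)
    (H-S : ∀ A → InH S A ↔ (InH Tδ A ⊎ InHε ε A))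
    (explainsS : ExplainsΔ S ts δ)
    (labs-spec : ∀ v → v ≢ root S → ∀ A → ClusterOf S v A → ∀ m →
                 (m ∈ labs v) ↔ (InHε ε A × (∃ λ y → IsU ε m y A)))
  where
  open Ancestry T P
  open ExplainedΕ T P lab ε explainsΕ
  private
    module S = Ancestry S S-phylo

  H-S⊆H : ∀ {A} → InH S A → InH T A
  H-S⊆H S-cluster with proj₁ (H-S _) S-cluster
  ... | inj₂ A∈Hε = InHε⇒InH A∈Hε
  ... | inj₁ (j , j-cluster) with distinguished-cluster Tδ Tδ-phylo tδ explainsδ T P t explainsΔ j
                                    (discriminating⇒distinguished Tδ tδ Tδ-discriminating j)
  ...   | v , j≈v = v , sameLeaves-cluster Tδ T j-cluster j≈v

  distinguished⇒H-S : ∀ v → Distinguished T t v → InH S (leafSet v)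
  distinguished⇒H-S v distinguished with distinguished-cluster T P t explainsΔ Tδ Tδ-phylo tδ explainsδ v distinguished
  ... | j , v≈j = proj₂ (H-S (leafSet v)) (inj₁ (j , sameLeaves-cluster T Tδ (leafSet-isCluster v) v≈j))

  -- Abstract, as unfolding the case analysis behind image exhausts the type checker.
  abstract
    image : S.V → V
    image v = proj₁ (H-S⊆H (v , S.leafSet-isCluster v))

    image-sameLeaves : ∀ v → SameLeaves S T v (image v)
    image-sameLeaves v = clusters⇒sameLeaves S T (S.leafSet-isCluster v) (proj₂ (H-S⊆H (v , S.leafSet-isCluster v)))

  image-≺ : ∀ {u v} → u S.≺ v → image u ≺ image v
  image-≺ = sameLeaves-≺ S S-phylo T P (image-sameLeaves _) (image-sameLeaves _)

  image-inner : ∀ {v} → IsInner S v → IsInner T (image v)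
  image-inner = sameLeaves-inner S S-phylo T P (image-sameLeaves _)

  image-label : ∀ {v} → IsInner S v → t (image v) ≡ ts v
  image-label {v} inner with phylogenetic (image v) (image-inner inner)
  ... | a , b , a≢b , a-child , b-child with leaf-below a | leaf-below b
  ...   | x₁ , x₁≼a | x₂ , x₂≼b =
          trans (explainsΔ x₁ x₂ x₁≢x₂ _ (lca-of-separated a-child b-child a≢b x₁≼a x₂≼b))
                (sym (explainsS x₁ x₂ x₁≢x₂ v (x₁≼ₛv , x₂≼ₛv , lowest)))
    where
    x₁≢x₂ : x₁ ≢ x₂
    x₁≢x₂ refl = a≢b (children-disjoint a-child b-child x₁≼a x₂≼b)
    x₁≼ₛv : S._≼_ (leaf S x₁) v
    x₁≼ₛv = proj₂ (image-sameLeaves v x₁) (≼-trans x₁≼a (child-≼ a-child))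
    x₂≼ₛv : S._≼_ (leaf S x₂) v
    x₂≼ₛv = proj₂ (image-sameLeaves v x₂) (≼-trans x₂≼b (child-≼ b-child))
    lowest : ∀ w → S._≼_ (leaf S x₁) w → S._≼_ (leaf S x₂) w → S._≼_ v w
    lowest w x₁≼w x₂≼w with S.≼-total x₁≼ₛv x₁≼w
    ... | inj₁ v≼w = v≼w
    ... | inj₂ w≼v with w ≟ v
    ...   | yes refl = S.≼-refl
    ...   | no  w≢v with image-≺ (w≼v , w≢v)
    ...     | w′≼v′ , w′≢v′ = contradiction (≼-antisym w′≼v′ (separated⇒parent≼ a-child b-child a≢b x₁≼a x₂≼b
                                (proj₁ (image-sameLeaves w x₁) x₁≼w) (proj₁ (image-sameLeaves w x₂) x₂≼w))) w′≢v′

  image-cluster : ∀ u → ClusterOf T (image u) (S.leafSet u)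
  image-cluster u = sameLeaves-cluster S T (S.leafSet-isCluster u) (image-sameLeaves u)

  image-labelled : ∀ {u v m} → IsChild S u v → m ∈ labs u → m ∈ lab (image u)
  image-labelled {u} {v} {m} u-child m∈labs
    with proj₂ (proj₁ (labs-spec u (proj₁ u-child) (S.leafSet u) (S.leafSet-isCluster u) m) m∈labs)
  ... | y , A-isU = U-cluster-labelled (image-cluster u) A-isU (≺⇒≢root (image-≺ (S.child-≺ u-child)))

  -- A label change strictly between image u and image v would make its cluster one of T_δ, hence of S.
  no-change-between : ∀ {u v} → IsChild S u v → ∀ s → image u ≺ s → s ≺ image v → t (parent T s) ≡ t s
  no-change-between {u} {v} u-child s u′≺s s≺v′ = decidable-stable (t (parent T s) ≟ t s) λ change →
    let (s* , s*-cluster) = distinguished⇒H-S s (inj₂ (inj₂ change))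
        s≈s* = clusters⇒sameLeaves T S (leafSet-isCluster s) s*-cluster
        u≺s* = sameLeaves-≺ T P S S-phylo (sameLeaves-sym S T (image-sameLeaves u)) s≈s* u′≺s
        s*≺v = sameLeaves-≺ T P S S-phylo s≈s* (sameLeaves-sym S T (image-sameLeaves v)) s≺v′
    in proj₂ s*≺v (S.≼-antisym (proj₁ s*≺v) (subst (S._≼ s*) (proj₂ u-child) (S.≺⇒parent≼ u≺s*)))

  condC : CondC T lab → CondC S labs
  condC CC v inner with descend-to-leaf EmptyPathTo step (image v) (≼-refl , nothing-strictly-between)
    where
    EmptyPathTo : V → Set
    EmptyPathTo w = w ≼ image v × (∀ q → w ≼ q → q ≺ image v → Empty (lab q))
    nothing-strictly-between : ∀ q → image v ≼ q → q ≺ image v → Empty (lab q)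
    nothing-strictly-between q v′≼q (q≼v′ , q≢v′) = contradiction (≼-antisym q≼v′ v′≼q) q≢v′
    step : ∀ w → EmptyPathTo w → IsInner T w → ∃ λ c → IsChild T c w × EmptyPathTo c
    step w (w≼v′ , empty) w-inner with CC w w-inner
    ... | c , c-child , c-empty = c , c-child , ≼-trans (child-≼ c-child) w≼v′ , empty′
      where
      empty′ : ∀ q → c ≼ q → q ≺ image v → Empty (lab q)
      empty′ q c≼q q≺v′ with c ≟ q
      ... | yes refl = c-empty
      ... | no  c≢q  = empty q (subst (_≼ q) (proj₂ c-child) (≺⇒parent≼ (c≼q , c≢q))) q≺v′
  ... | y , y≼v′ , _ , y-path with S.child-on-path (proj₂ (image-sameLeaves v y) y≼v′ , S.leaf≢inner inner)
  ...   | c , c-child , y≼c = c , c-child , λ (m , m∈labs) →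
          y-path (image c) (proj₁ (image-sameLeaves c y) y≼c) (image-≺ (S.child-≺ c-child)) (m , image-labelled c-child m∈labs)

  condC1 : ∀ {M∅} → CondC1 T M∅ t lab → CondC1 S M∅ ts labs
  condC1 {M∅} CC1 v inner tsᵥ∈M∅ u u-child (m , m∈labs) =
    CC1 (parent T u′) (u′ , u′-child) tₚᵤ′∈M∅ u′ u′-child (m , image-labelled u-child m∈labs)
    where
    u′ : V
    u′ = image u
    u′≺v′ : u′ ≺ image v
    u′≺v′ = image-≺ (S.child-≺ u-child)
    u′-child : IsChild T u′ (parent T u′)
    u′-child = ≺⇒≢root u′≺v′ , refl
    tₚᵤ′≡tᵥ′ : t (parent T u′) ≡ t (image v)
    tₚᵤ′≡tᵥ′ = constant-on-path t (≺⇒parent≼ u′≺v′) λ s pu′≼s s≺v′ →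
      no-change-between u-child s (≺-≼-trans (child-≺ u′-child) pu′≼s) s≺v′
    tₚᵤ′∈M∅ : t (parent T u′) ∈ M∅
    tₚᵤ′∈M∅ = subst (_∈ M∅) (sym (trans tₚᵤ′≡tᵥ′ (image-label inner))) tsᵥ∈M∅

module Sufficiency {n p k : ℕ} {δ : Fin n → Fin n → Fin p} {ε : Fin n → Fin n → Subset k}
    (T : RawTree n) (P : IsPhylo T) (t : Vtx T → Fin p) (lab : Vtx T → Subset k)
    (explainsΔ : ExplainsΔ T t δ) (explainsΕ : ExplainsΕ T lab ε) where
  open Ancestry T P
  open ExplainedΕ T P lab ε explainsΕ

  IsUCluster : V → Set
  IsUCluster v = ∃₂ λ y m → IsU ε m y (leafSet v)

  KeptInS : V → Set
  KeptInS v = Distinguished T t v ⊎ IsUCluster v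

  leaf-distinguished : ∀ x → Distinguished T t (leaf T x)
  leaf-distinguished x = inj₂ (inj₁ (leaf-noChild x))

  module Cδ = Contraction T P (distinguished? T t) (inj₁ refl) leaf-distinguished
  keptInS? : Decidable KeptInS
  keptInS? v = distinguished? T t v ⊎-dec Finₚ.any? λ y → Finₚ.any? λ m → IsU? ε m y (leafSet v)

  module C* = Contraction T P keptInS? (inj₁ (inj₁ refl)) (inj₁ ∘ leaf-distinguished)

  label-constant : ∀ q → ¬ Distinguished T t q → t (parent T q) ≡ t q
  label-constant q ¬distinguished =
    decidable-stable (t (parent T q) ≟ t q) λ change → ¬distinguished (inj₂ (inj₂ change))

  Tδ : RawTree n
  Tδ = Cδ.T′

  tδ : Vtx Tδ → Fin p
  tδ = t ∘ Cδ.e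

  S : RawTree n
  S = C*.T′

  ts : Vtx S → Fin p
  ts = t ∘ C*.e

  private
    module S = Ancestry S C*.isPhylo′

  labs : Vtx S → Subset k
  labs i = tabulate (does ∘ λ m → Finₚ.any? λ y → IsU? ε m y (S.leafSet i))

  ∈labs↔ : ∀ i m → (m ∈ labs i) ↔ (∃ λ y → IsU ε m y (S.leafSet i))
  ∈labs↔ i = ∈-tabulate-does (λ m → Finₚ.any? λ y → IsU? ε m y (S.leafSet i))

  explainsδ : ExplainsΔ Tδ tδ δ
  explainsδ = Cδ.contraction-explainsΔ t label-constant explainsΔ

  explainsS : ExplainsΔ S ts δ
  explainsS = C*.contraction-explainsΔ t (λ q ¬kept → label-constant q (¬kept ∘ inj₁)) explainsΔ

  Tδ-discriminating : Discriminating Tδ tδ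
  Tδ-discriminating i i≢r inner tₚᵢ≡tᵢ =
    distinguished-inner⇒change T t (Cδ.e-kept i) (i≢r ∘ Cδ.e≡root⇒≡root′) (Cδ.inner′⇒inner inner) (begin
      t (parent T (Cδ.e i))           ≡⟨ Cδ.constant-up-to-kept t label-constant (parent T (Cδ.e i)) ⟩
      t (Cδ.up (parent T (Cδ.e i)))   ≡⟨ cong t (Cδ.e-parent i) ⟨
      tδ (parent Tδ i)                ≡⟨ tₚᵢ≡tᵢ ⟩
      tδ i                            ∎)
    where open ≡-Reasoning

  H-S : ∀ A → InH S A ↔ (InH Tδ A ⊎ InHε ε A)
  H-S A = S⇒ , ⇒S
    where
    S⇒ : InH S A → InH Tδ A ⊎ InHε ε A
    S⇒ S-cluster with C*.InH′⇒kept S-cluster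
    ... | v , inj₁ distinguished , v-cluster = inj₁ (Cδ.kept⇒InH′ distinguished v-cluster)
    ... | v , inj₂ (y , m , v-isU) , v-cluster =
      inj₂ (inj₁ (y , m , IsU-resp ε v-isU (cluster-≗ T (leafSet-isCluster v) v-cluster)))
    ⇒S : InH Tδ A ⊎ InHε ε A → InH S A
    ⇒S (inj₁ Tδ-cluster) with Cδ.InH′⇒kept Tδ-cluster
    ... | v , distinguished , v-cluster = C*.kept⇒InH′ (inj₁ distinguished) v-cluster
    ⇒S (inj₂ A∈Hε) = C*.kept⇒InH′ (Hε-vertex-kept A∈Hε) (proj₂ (InHε⇒InH A∈Hε))
      where
      Hε-vertex-kept : (A∈Hε : InHε ε A) → KeptInS (proj₁ (InHε⇒InH A∈Hε))
      Hε-vertex-kept (inj₁ (y , m , _))     = inj₂ (y , m , uVertex-isU y m)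
      Hε-vertex-kept (inj₂ (inj₁ _))        = inj₁ (inj₁ refl)
      Hε-vertex-kept (inj₂ (inj₂ (y , _))) = inj₁ (leaf-distinguished y)

  labs-spec : ∀ i → i ≢ root S → ∀ A → ClusterOf S i A → ∀ m → (m ∈ labs i) ↔ (InHε ε A × (∃ λ y → IsU ε m y A))
  labs-spec i _ A i-cluster m = ∈labs⇒ , ⇒∈labs
    where
    ∈labs⇒ : m ∈ labs i → InHε ε A × (∃ λ y → IsU ε m y A)
    ∈labs⇒ m∈labs = let (y , i-isU) = proj₁ (∈labs↔ i m) m∈labs
                        A-isU = IsU-resp ε i-isU (cluster-≗ S (S.leafSet-isCluster i) i-cluster)
                    in inj₁ (y , m , A-isU) , (y , A-isU)
    ⇒∈labs : InHε ε A × (∃ λ y → IsU ε m y A) → m ∈ labs i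
    ⇒∈labs (_ , y , A-isU) = proj₂ (∈labs↔ i m) (y , IsU-resp ε A-isU (cluster-≗ S i-cluster (S.leafSet-isCluster i)))

  U-vertexₛ : ∀ y m → ∃ λ i → IsU ε m y (S.leafSet i)
  U-vertexₛ y m = let (i , i-cluster) = C*.kept⇒InH′ (inj₂ (y , m , uVertex-isU y m)) (leafSet-isCluster (uVertex y m))
                  in i , IsU-resp ε (uVertex-isU y m) (cluster-≗ S i-cluster (S.leafSet-isCluster i))

  explainsΕS : ExplainsΕ S labs ε
  explainsΕS = U-labelled⇒explainsΕ ε U-nested S C*.isPhylo′ labs U-vertexₛ λ i _ → ∈labs↔ i

  leastResolved : IsLeastResolved δ ε S ts labs
  leastResolved = C*.isPhylo′ , (Tδ , tδ , Cδ.isPhylo′ , explainsδ , Tδ-discriminating , H-S) , explainsS , labs-spec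

theorem3 : (n p k : ℕ) (δ : Fin n → Fin n → Fin p) (ε : Fin n → Fin n → Subset k)
           (M∅ : Subset p) →
           M∅TreeLike δ ε M∅ ↔
             (TreeLike δ ε ×
               ((T : RawTree n) (t : Vtx T → Fin p) (lab : Vtx T → Subset k) →
                 IsLeastResolved δ ε T t lab → CondC T lab × CondC1 T M∅ t lab))
theorem3 n p k δ ε M∅ = necessary , sufficient
  where
  LeastResolvedSatisfiesC : Set
  LeastResolvedSatisfiesC = (T : RawTree n) (t : Vtx T → Fin p) (lab : Vtx T → Subset k) →
                            IsLeastResolved δ ε T t lab → CondC T lab × CondC1 T M∅ t lab

  necessary : M∅TreeLike δ ε M∅ → TreeLike δ ε × LeastResolvedSatisfiesC
  necessary (T , t , lab , P , explainsΔ , explainsΕ , C , C1) = (T , t , lab , P , explainsΔ , explainsΕ) ,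
    λ { S ts labs (S-phylo , (Tδ , tδ , Tδ-phylo , explainsδ , Tδ-discriminating , H-S) , explainsS , labs-spec) →
        let open Necessity T P t lab explainsΔ explainsΕ S S-phylo ts labs Tδ tδ Tδ-phylo explainsδ
                           Tδ-discriminating H-S explainsS labs-spec
        in condC C , condC1 C1 }

  sufficient : TreeLike δ ε × LeastResolvedSatisfiesC → M∅TreeLike δ ε M∅
  sufficient ((T , t , lab , P , explainsΔ , explainsΕ) , least-resolved-satisfies-C) =
    S , ts , labs , C*.isPhylo′ , explainsS , explainsΕS , least-resolved-satisfies-C S ts labs leastResolved
    where open Sufficiency T P t lab explainsΔ explainsΕ
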